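{- Let $\mathcal{M}$ be a non standard $n+1$-valued Kripke model, $\phi$ a formula and $\alpha$ a program. If $\mathcal{M}\models(\phi\to[\alpha]\phi)^n$, then $\mathcal{M}\models\phi\to[\alpha^*]\phi$.
   Context: Language: nonempty $\Pi_0$ of atomic programs, countable $\mathsf{Prop}$; formulas $\phi::=p\mid0\mid\neg\phi\mid\phi\to\phi\mid[\alpha]\phi$, programs $\alpha::=a\mid\phi?\mid\alpha;\alpha\mid\alpha\cup\alpha\mid\alpha^*$; $\Pi$ the set of programs. Abbreviations: $\phi\vee\psi:=(\phi\to\psi)\to\psi$, $\phi\wedge\psi:=\neg(\neg\phi\vee\neg\psi)$, $\phi\oplus\psi:=\neg\phi\to\psi$, $\phi\odot\psi:=\neg(\neg\phi\oplus\neg\psi)$, $\psi^k$ the $\odot$-product of $k$ copies of $\psi$. $\mathrm{L}_n=\{i/n:0\le i\le n\}$ with $\neg x=1-x$, $x\to y=\min(1-x+y,1)$. A weak non standard $n+1$-valued Kripke model $\mathcal{M}=\langle W,R,\mathrm{Val}\rangle$: nonempty $W$, a relation $R_\alpha\subseteq W\times W$ for every $\alpha\in\Pi$, $\mathrm{Val}:W\times\mathsf{Prop}\to\mathrm{L}_n$ extended by $\mathrm{Val}(w,0)=0$, $\mathrm{Val}(w,\phi\to\psi)=\mathrm{Val}(w,\phi)\to\mathrm{Val}(w,\psi)$, $\mathrm{Val}(w,\neg\psi)=1-\mathrm{Val}(w,\psi)$, $\mathrm{Val}(w,[\alpha]\psi)=\bigwedge\{\mathrm{Val}(v,\psi):(w,v)\in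 R_\alpha\}$ (empty infimum $=1$). $\mathcal{M}\models\chi$ means $\mathrm{Val}(w,\chi)=1$ for all $w\in W$. It is a non standard model if for all $\alpha,\beta\in\Pi$ and $\psi\in\mathsf{Form}$: (i) $R_{\alpha;\beta}=R_\alpha\circ R_\beta$ (with $R\circ R'=\{(u,w):\exists v\,(uRv\,\&\,vR'w)\}$), $R_{\alpha\cup\beta}=R_\alpha\cup R_\beta$, $R_{\psi?}=\{(u,u):\mathrm{Val}(u,\psi)=1\}$; (ii) $R_{\alpha^*}$ is reflexive, transitive and contains $R_\alpha$; (iii) for every formula $\phi$, $\mathcal{M}\models[\alpha^*]\phi\to(\phi\wedge[\alpha][\alpha^*]\phi)$, $\mathcal{M}\models[\alpha^*]\phi\to[\alpha^*][\alpha^*]\phi$ and $\mathcal{M}\models(\phi\wedge[\alpha^*](\phi\to[\alpha]\phi)^n)\to[\alpha^*]\phi$. -}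

module Defs where

open import Data.Nat using (ℕ; zero; suc; _+_; _∸_; _⊓_; _≤_)
open import Data.Product using (Σ; _×_)
open import Data.Sum using (_⊎_)
open import Relation.Binary.PropositionalEquality using (_≡_)
open import Function.Bundles using (_⇔_)

-- Propositional variables: Prop = ℕ (countable).
-- Atomic programs: an arbitrary type Π₀ (nonemptiness is assumed in the statement).

mutual
  data Form (Π₀ : Set) : Set where
    var  : ℕ → Form Π₀
    ⊥f   : Form Π₀
    ¬f_  : Form Π₀ → Form Π₀
    _⇒_  : Form Π₀ → Form Π₀ → Form Π₀
    [_]_ : Prog Π₀ → Form Π₀ → Form Π₀

  data Prog (Π₀ : Set) : Set where
    atom : Π₀ → Prog Π₀
    _¿   : Form Π₀ → Prog Π₀
    _︔_  : Prog Π₀ → Prog Π₀ → Prog Π₀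
    _∪p_ : Prog Π₀ → Prog Π₀ → Prog Π₀
    _⋆   : Prog Π₀ → Prog Π₀

infixr 5 _⇒_

module _ {Π₀ : Set} where
  _∨f_ : Form Π₀ → Form Π₀ → Form Π₀
  φ ∨f ψ = (φ ⇒ ψ) ⇒ ψ

  _∧f_ : Form Π₀ → Form Π₀ → Form Π₀
  φ ∧f ψ = ¬f ((¬f φ) ∨f (¬f ψ))

  _⊕_ : Form Π₀ → Form Π₀ → Form Π₀
  φ ⊕ ψ = (¬f φ) ⇒ ψ

  _⊙_ : Form Π₀ → Form Π₀ → Form Π₀
  φ ⊙ ψ = ¬f ((¬f φ) ⊕ (¬f ψ))

  -- ψ ^ k : the ⊙-product of k copies of ψ (ψ^1 = ψ, ψ^(k+1) = ψ ⊙ ψ^k).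
  -- For k = 0 we use the ⊙-unit ¬0 (only k ≥ 1 is used: n ≥ 1).
  _^f_ : Form Π₀ → ℕ → Form Π₀
  ψ ^f zero          = ¬f ⊥f
  ψ ^f suc zero      = ψ
  ψ ^f suc (suc k)   = ψ ⊙ (ψ ^f suc k)

-- Truth values of Ł_n are represented by their numerators i ∈ {0,…,n}
-- (value i/n). Here n is a parameter; the value 1 is the numerator n.
negV : ℕ → ℕ → ℕ
negV n x = n ∸ x

impV : ℕ → ℕ → ℕ → ℕ
impV n x y = n ⊓ ((n ∸ x) + y)

_∘R_ : {W : Set} → (W → W → Set) → (W → W → Set) → (W → W → Set)
(R ∘R R') u w = Σ _ (λ v → R u v × R' v w)

-- The valuation is given on all formulas and
-- required to satisfy the recursive clauses; the box clause says that
-- val w ([α]ψ) is the infimum (greatest lower bound in Ł_n) of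
-- { val v ψ : (w,v) ∈ R_α } (empty infimum = n, i.e. 1).
record WeakModel (Π₀ : Set) (n : ℕ) : Set₁ where
  field
    W       : Set
    w₀      : W
    R       : Prog Π₀ → W → W → Set
    val     : W → Form Π₀ → ℕ
    val≤n   : ∀ w φ → val w φ ≤ n
    val-⊥   : ∀ w → val w ⊥f ≡ 0
    val-⇒   : ∀ w φ ψ → val w (φ ⇒ ψ) ≡ impV n (val w φ) (val w ψ)
    val-¬   : ∀ w ψ → val w (¬f ψ) ≡ negV n (val w ψ)
    val-□lb : ∀ w α ψ v → R α w v → val w ([ α ] ψ) ≤ val v ψ
    val-□gl : ∀ w α ψ k → k ≤ n → (∀ v → R α w v → k ≤ val v ψ) →
              k ≤ val w ([ α ] ψ)

  _⊨_ : Form Π₀ → Set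
  _⊨_ χ = ∀ w → val w χ ≡ n

record IsNonStandard {Π₀ : Set} {n : ℕ} (M : WeakModel Π₀ n) : Set₁ where
  open WeakModel M
  field
    R-︔   : ∀ α β u w → R (α ︔ β) u w ⇔ (R α ∘R R β) u w
    R-∪   : ∀ α β u w → R (α ∪p β) u w ⇔ (R α u w ⊎ R β u w)
    R-?   : ∀ ψ u w → R (ψ ¿) u w ⇔ (u ≡ w × val u ψ ≡ n)
    R⋆-refl  : ∀ α u → R (α ⋆) u u
    R⋆-trans : ∀ α u v w → R (α ⋆) u v → R (α ⋆) v w → R (α ⋆) u w
    R⋆-incl  : ∀ α u v → R α u v → R (α ⋆) u v
    ax-fix  : ∀ α φ → _⊨_ (([ α ⋆ ] φ) ⇒ (φ ∧f ([ α ] ([ α ⋆ ] φ))))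
    ax-4    : ∀ α φ → _⊨_ (([ α ⋆ ] φ) ⇒ ([ α ⋆ ] ([ α ⋆ ] φ)))
    ax-ind  : ∀ α φ → _⊨_ ((φ ∧f ([ α ⋆ ] ((φ ⇒ ([ α ] φ)) ^f n))) ⇒ ([ α ⋆ ] φ))

module Submission where

-- The induction axiom (iii) of a non standard model reads
--   φ ∧ [α*]((φ → [α]φ)^n) → [α*]φ .
-- Under the hypothesis M ⊨ (φ → [α]φ)^n, necessitation (a formula true at
-- every world is true under any box) makes [α*]((φ → [α]φ)^n) take the value
-- 1 everywhere, and in Ł_n the conjunction x ∧ 1 equals x.  Hence the
-- antecedent of the induction axiom has, at every world, the same value as
-- φ, so the induction axiom is literally φ → [α*]φ.

open import Defs
open import Data.Nat using (ℕ; _≤_; _⊓_; _∸_)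
open import Data.Nat.Properties
  using (≤-antisym; ≤-refl; ≤-reflexive; m∸n≤m; m∸[m∸n]≡n; m≥n⇒m⊓n≡n; n∸n≡0; +-identityʳ)
open import Relation.Binary.PropositionalEquality
  using (_≡_; sym; trans; cong; cong₂; module ≡-Reasoning)

joinV : ℕ → ℕ → ℕ → ℕ
joinV n x y = impV n (impV n x y) y

meetV : ℕ → ℕ → ℕ → ℕ
meetV n x y = negV n (joinV n (negV n x) (negV n y))

negV-involutive : ∀ n {x} → x ≤ n → negV n (negV n x) ≡ x
negV-involutive n x≤n = m∸[m∸n]≡n x≤n

impV-zeroʳ : ∀ n x → impV n x 0 ≡ negV n x
impV-zeroʳ n x = trans (cong (n ⊓_) (+-identityʳ (n ∸ x))) (m≥n⇒m⊓n≡n (m∸n≤m n x))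

joinV-zeroʳ : ∀ n {x} → x ≤ n → joinV n x 0 ≡ x
joinV-zeroʳ n {x} x≤n = begin
  impV n (impV n x 0) 0   ≡⟨ impV-zeroʳ n (impV n x 0) ⟩
  negV n (impV n x 0)     ≡⟨ cong (negV n) (impV-zeroʳ n x) ⟩
  negV n (negV n x)       ≡⟨ negV-involutive n x≤n ⟩
  x                       ∎
  where open ≡-Reasoning

meetV-oneʳ : ∀ n {x} → x ≤ n → meetV n x n ≡ x
meetV-oneʳ n {x} x≤n = begin
  negV n (joinV n (negV n x) (negV n n))  ≡⟨ cong (λ z → negV n (joinV n (negV n x) z)) (n∸n≡0 n) ⟩
  negV n (joinV n (negV n x) 0)           ≡⟨ cong (negV n) (joinV-zeroʳ n (m∸n≤m n x)) ⟩
  negV n (negV n x)                       ≡⟨ negV-involutive n x≤n ⟩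
  x                                       ∎
  where open ≡-Reasoning

module _ {Π₀ : Set} {n : ℕ} (M : WeakModel Π₀ n) where
  open WeakModel M

  val-∨ : ∀ w φ ψ → val w (φ ∨f ψ) ≡ joinV n (val w φ) (val w ψ)
  val-∨ w φ ψ = trans (val-⇒ w (φ ⇒ ψ) ψ) (cong (λ z → impV n z (val w ψ)) (val-⇒ w φ ψ))

  val-∧ : ∀ w φ ψ → val w (φ ∧f ψ) ≡ meetV n (val w φ) (val w ψ)
  val-∧ w φ ψ = begin
    val w (¬f ((¬f φ) ∨f (¬f ψ)))               ≡⟨ val-¬ w _ ⟩
    negV n (val w ((¬f φ) ∨f (¬f ψ)))           ≡⟨ cong (negV n) (val-∨ w (¬f φ) (¬f ψ)) ⟩
    negV n (joinV n (val w (¬f φ)) (val w (¬f ψ)))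
      ≡⟨ cong₂ (λ a b → negV n (joinV n a b)) (val-¬ w φ) (val-¬ w ψ) ⟩
    meetV n (val w φ) (val w ψ)                 ∎
    where open ≡-Reasoning

  val-∧-trueʳ : ∀ w φ ψ → val w ψ ≡ n → val w (φ ∧f ψ) ≡ val w φ
  val-∧-trueʳ w φ ψ ψ-true = begin
    val w (φ ∧f ψ)               ≡⟨ val-∧ w φ ψ ⟩
    meetV n (val w φ) (val w ψ)  ≡⟨ cong (meetV n (val w φ)) ψ-true ⟩
    meetV n (val w φ) n          ≡⟨ meetV-oneʳ n (val≤n w φ) ⟩
    val w φ                      ∎
    where open ≡-Reasoning

  necessitation : ∀ β ψ → _⊨_ ψ → _⊨_ ([ β ] ψ)
  necessitation β ψ ⊨ψ w =
    ≤-antisym (val≤n w ([ β ] ψ))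
              (val-□gl w β ψ n ≤-refl (λ v _ → ≤-reflexive (sym (⊨ψ v))))

  val-⇒-antecedent : ∀ w φ φ′ ψ → val w φ ≡ val w φ′ → val w (φ ⇒ ψ) ≡ val w (φ′ ⇒ ψ)
  val-⇒-antecedent w φ φ′ ψ eq = begin
    val w (φ ⇒ ψ)                ≡⟨ val-⇒ w φ ψ ⟩
    impV n (val w φ) (val w ψ)   ≡⟨ cong (λ a → impV n a (val w ψ)) eq ⟩
    impV n (val w φ′) (val w ψ)  ≡⟨ sym (val-⇒ w φ′ ψ) ⟩
    val w (φ′ ⇒ ψ)               ∎
    where open ≡-Reasoning

lemmaA3 : {Π₀ : Set} → Π₀ → (n : ℕ) → 1 ≤ n →
          (M : WeakModel Π₀ n) → IsNonStandard M →
          (φ : Form Π₀) (α : Prog Π₀) →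
          WeakModel._⊨_ M ((φ ⇒ ([ α ] φ)) ^f n) →
          WeakModel._⊨_ M (φ ⇒ ([ α ⋆ ] φ))
lemmaA3 _ n _ M NS φ α ⊨χ w =
  trans (val-⇒-antecedent M w φ (φ ∧f ([ α ⋆ ] χ)) ([ α ⋆ ] φ) (sym φ∧□χ≈φ))
        (IsNonStandard.ax-ind NS α φ w)
  where
  χ = (φ ⇒ ([ α ] φ)) ^f n
  φ∧□χ≈φ : WeakModel.val M w (φ ∧f ([ α ⋆ ] χ)) ≡ WeakModel.val M w φ
  φ∧□χ≈φ = val-∧-trueʳ M w φ ([ α ⋆ ] χ) (necessitation M (α ⋆) χ ⊨χ w)
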